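{- Let $\mathcal{C}$ be a category with finite products and finite coproducts, and let $E$ be an object of $\mathcal{C}$ (the object of exceptions). Assume $\mathcal{C}$ is extensive with respect to $E$: for every morphism $f\colon A\to B+E$, the pullbacks of the coprojections $\mathrm{copr}_1\colon B\to B+E$ and $\mathrm{copr}_2\colon E\to B+E$ along $f$ exist, say $i_f\colon \mathcal{D}_f\to A$ with $f_{\mathrm{normal}}\colon\mathcal{D}_f\to B$ (so $f\circ i_f=\mathrm{copr}_1\circ f_{\mathrm{normal}}$) and $j_f\colon\mathcal{E}_f\to A$ with $f_{\mathrm{abrupt}}\colon\mathcal{E}_f\to E$, and $i_f,j_f$ exhibit $A$ as a coproduct $A\cong\mathcal{D}_f+\mathcal{E}_f$. Consider the programmer's language for exceptions whose pure terms $A\to B$ are morphisms $A\to B$ of $\mathcal{C}$ and whose general terms (propagators) $A\to B$ are morphisms $A\to B+E$ of $\mathcal{C}$, as described in the context. Then this language is compatible with conditionals and with sequential pairs with respect to the relation $\gg$ defined by: for a pure term $v\colon A\to B$ and a propagator $f\colon A\to B$, $v\gg f$ iff $v\circ i_f=f_{\mathrm{normal}}\colon\mathcal{D}_f\to B$. Explicitly: (1) for all propagators $f_1\colon A_1\to B$, $f_2\colon A_2\to B$ there is a unique propagator $h\colon A_1+A_2\to B$ with $h\circ\mathrm{copr}_1=f_1$ and $h\circ\mathrm{copr}_2=f_2$; (2) for every pure $f_1\colon A\to B_1$ and propagator $f_2\colon A\to B_2$ there is a unique propagator $\langle f_1,f_2\rangle_l\colon A\to B_1\times B_2$ with $f_1\gg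 \mathrm{pr}_1\circ\langle f_1,f_2\rangle_l$ and $\mathrm{pr}_2\circ\langle f_1,f_2\rangle_l=f_2$, and symmetrically for every propagator $f_1\colon A\to B_1$ and pure $f_2\colon A\to B_2$ there is a unique propagator $\langle f_1,f_2\rangle_r\colon A\to B_1\times B_2$ with $\mathrm{pr}_1\circ\langle f_1,f_2\rangle_r=f_1$ and $f_2\gg\mathrm{pr}_2\circ\langle f_1,f_2\rangle_r$ (compositions and equalities taken among propagators).
   Context: The monad of exceptions on $\mathcal{C}$ has endofunctor $X\mapsto X+E$, unit $\eta_X\colon X\to X+E$ the coprojection, and multiplication $\mu_X=[\mathrm{id}_{X+E}\mid \mathrm{copr}_X]\colon (X+E)+E\to X+E$. In the programmer's language for exceptions, a pure term $v\colon A\to B$ is a morphism $v\colon A\to B$ of $\mathcal{C}$, regarded as the propagator $\eta_B\circ v$; a propagator (general term) $f\colon A\to B$ is a morphism $f\colon A\to B+E$ of $\mathcal{C}$; propagators compose in the Kleisli way: $g\circ f=\mu_C\circ(g+\mathrm{id}_E)\circ f$ for $f\colon A\to B+E$, $g\colon B\to C+E$; equality of propagators is equality of the morphisms into $B+E$. Projections and coprojections are pure. A language with effects (pure terms forming a category $\mathcal{C}$ with finite products and coproducts, general terms forming a larger category with the same objects) is compatible with conditionals if copairs of general terms exist uniquely as in (1), and compatible with sequential pairs with respect to a relation $\gg$ between pure and general terms (which is equality when both are pure) if left and right pairs of a pure term and a general term exist uniquely as in (2). -}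

module Defs where

open import Level using (Level; _⊔_; suc)
open import Data.Unit.Polymorphic using (⊤)
open import Data.Product using (Σ; _×_; _,_; proj₁; proj₂; ∃!)
open import Relation.Binary.PropositionalEquality using (_≡_)

record Category (o ℓ : Level) : Set (suc (o ⊔ ℓ)) where
  infixr 9 _∘_
  infix 4 _⇒_
  field
    Obj  : Set o
    _⇒_  : Obj → Obj → Set ℓ
    id   : ∀ {A} → A ⇒ A
    _∘_  : ∀ {A B C} → B ⇒ C → A ⇒ B → A ⇒ C
    identityˡ : ∀ {A B} (f : A ⇒ B) → id ∘ f ≡ f
    identityʳ : ∀ {A B} (f : A ⇒ B) → f ∘ id ≡ f
    assoc     : ∀ {A B C D} (f : A ⇒ B) (g : B ⇒ C) (h : C ⇒ D) →
                (h ∘ g) ∘ f ≡ h ∘ (g ∘ f)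

module _ {o ℓ : Level} (𝒞 : Category o ℓ) where
  open Category 𝒞

  IsTerminal : Obj → Set (o ⊔ ℓ)
  IsTerminal T = ∀ (X : Obj) → ∃! _≡_ (λ (_ : X ⇒ T) → ⊤ {ℓ})

  IsInitial : Obj → Set (o ⊔ ℓ)
  IsInitial I = ∀ (X : Obj) → ∃! _≡_ (λ (_ : I ⇒ X) → ⊤ {ℓ})

  IsProduct : ∀ {A B P} → P ⇒ A → P ⇒ B → Set (o ⊔ ℓ)
  IsProduct {A} {B} {P} p₁ p₂ =
    ∀ {X} (f : X ⇒ A) (g : X ⇒ B) →
      ∃! _≡_ (λ (h : X ⇒ P) → (p₁ ∘ h ≡ f) × (p₂ ∘ h ≡ g))

  IsCoproduct : ∀ {A B S} → A ⇒ S → B ⇒ S → Set (o ⊔ ℓ)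
  IsCoproduct {A} {B} {S} i₁ i₂ =
    ∀ {X} (f : A ⇒ X) (g : B ⇒ X) →
      ∃! _≡_ (λ (h : S ⇒ X) → (h ∘ i₁ ≡ f) × (h ∘ i₂ ≡ g))

  IsPullback : ∀ {A B C P} → A ⇒ C → B ⇒ C → P ⇒ A → P ⇒ B → Set (o ⊔ ℓ)
  IsPullback {A} {B} {C} {P} f g p q =
    (f ∘ p ≡ g ∘ q) ×
    (∀ {X} (a : X ⇒ A) (b : X ⇒ B) → f ∘ a ≡ g ∘ b →
       ∃! _≡_ (λ (u : X ⇒ P) → (p ∘ u ≡ a) × (q ∘ u ≡ b)))

  record FiniteProducts : Set (o ⊔ ℓ) where
    infixr 7 _×ₒ_
    field
      ⊤ₒ         : Obj
      ⊤-terminal : IsTerminal ⊤ₒ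
      _×ₒ_       : Obj → Obj → Obj
      π₁         : ∀ {A B} → (A ×ₒ B) ⇒ A
      π₂         : ∀ {A B} → (A ×ₒ B) ⇒ B
      isProduct  : ∀ {A B} → IsProduct (π₁ {A} {B}) (π₂ {A} {B})

  record FiniteCoproducts : Set (o ⊔ ℓ) where
    infixr 6 _+_
    field
      ⊥ₒ          : Obj
      ⊥-initial   : IsInitial ⊥ₒ
      _+_         : Obj → Obj → Obj
      inl         : ∀ {A B} → A ⇒ (A + B)
      inr         : ∀ {A B} → B ⇒ (A + B)
      isCoproduct : ∀ {A B} → IsCoproduct (inl {A} {B}) (inr {A} {B})

    [_,_] : ∀ {A B X} → A ⇒ X → B ⇒ X → (A + B) ⇒ X
    [ f , g ] = proj₁ (isCoproduct f g)

    _⊕_ : ∀ {A B C D} → A ⇒ C → B ⇒ D → (A + B) ⇒ (C + D)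
    f ⊕ g = [ inl ∘ f , inr ∘ g ]

  record ExtensiveAt (S : FiniteCoproducts) (E : Obj) {A B : Obj}
                     (f : A ⇒ FiniteCoproducts._+_ S B E) : Set (o ⊔ ℓ) where
    open FiniteCoproducts S
    field
      𝒟        : Obj
      ℰ        : Obj
      i        : 𝒟 ⇒ A
      normal   : 𝒟 ⇒ B
      j        : ℰ ⇒ A
      abrupt   : ℰ ⇒ E
      pullback₁ : IsPullback f (inl {B} {E}) i normal
      pullback₂ : IsPullback f (inr {B} {E}) j abrupt
      coproduct : IsCoproduct i j

  Extensive : FiniteCoproducts → Obj → Set (o ⊔ ℓ)
  Extensive S E = ∀ {A B} (f : A ⇒ FiniteCoproducts._+_ S B E) → ExtensiveAt S E f

  module ExceptionLanguage (P : FiniteProducts) (S : FiniteCoproducts) (E : Obj) where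
    open FiniteProducts P
    open FiniteCoproducts S

    Prop : Obj → Obj → Set ℓ
    Prop A B = A ⇒ (B + E)

    η : ∀ {X} → X ⇒ (X + E)
    η = inl

    μ : ∀ {X} → ((X + E) + E) ⇒ (X + E)
    μ = [ id , inr ]

    pure : ∀ {A B} → A ⇒ B → Prop A B
    pure v = η ∘ v

    infixr 9 _∘ₚ_
    _∘ₚ_ : ∀ {A B C} → Prop B C → Prop A B → Prop A C
    g ∘ₚ f = μ ∘ ((g ⊕ id) ∘ f)

    CompatibleWithConditionals : Set (o ⊔ ℓ)
    CompatibleWithConditionals =
      ∀ {A₁ A₂ B} (f₁ : Prop A₁ B) (f₂ : Prop A₂ B) →
        ∃! _≡_ (λ (h : Prop (A₁ + A₂) B) →
          (h ∘ₚ pure inl ≡ f₁) × (h ∘ₚ pure inr ≡ f₂))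

    CompatibleWithSequentialPairs :
      (∀ {A B} → A ⇒ B → Prop A B → Set ℓ) → Set (o ⊔ ℓ)
    CompatibleWithSequentialPairs _≫_ =
      (∀ {A B₁ B₂} (f₁ : A ⇒ B₁) (f₂ : Prop A B₂) →
         ∃! _≡_ (λ (h : Prop A (B₁ ×ₒ B₂)) →
           (f₁ ≫ (pure π₁ ∘ₚ h)) × (pure π₂ ∘ₚ h ≡ f₂)))
      ×
      (∀ {A B₁ B₂} (f₁ : Prop A B₁) (f₂ : A ⇒ B₂) →
         ∃! _≡_ (λ (h : Prop A (B₁ ×ₒ B₂)) →
           (pure π₁ ∘ₚ h ≡ f₁) × (f₂ ≫ (pure π₂ ∘ₚ h))))

    ≫ext : Extensive S E → ∀ {A B} → A ⇒ B → Prop A B → Set ℓ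
    ≫ext ext v f = v ∘ ExtensiveAt.i (ext f) ≡ ExtensiveAt.normal (ext f)

CompatibleWithConditionals : ∀ {o ℓ} (𝒞 : Category o ℓ) →
  FiniteProducts 𝒞 → FiniteCoproducts 𝒞 → Category.Obj 𝒞 → Set (o ⊔ ℓ)
CompatibleWithConditionals 𝒞 P S E = ExceptionLanguage.CompatibleWithConditionals 𝒞 P S E

CompatibleWithSequentialPairs : ∀ {o ℓ} (𝒞 : Category o ℓ) (P : FiniteProducts 𝒞)
  (S : FiniteCoproducts 𝒞) (E : Category.Obj 𝒞) →
  (∀ {A B} → Category._⇒_ 𝒞 A B → ExceptionLanguage.Prop 𝒞 P S E A B → Set ℓ) →
  Set (o ⊔ ℓ)
CompatibleWithSequentialPairs 𝒞 P S E = ExceptionLanguage.CompatibleWithSequentialPairs 𝒞 P S E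

≫-extensive : ∀ {o ℓ} (𝒞 : Category o ℓ) (P : FiniteProducts 𝒞)
  (S : FiniteCoproducts 𝒞) (E : Category.Obj 𝒞) → Extensive 𝒞 S E →
  ∀ {A B} → Category._⇒_ 𝒞 A B → ExceptionLanguage.Prop 𝒞 P S E A B → Set ℓ
≫-extensive 𝒞 P S E = ExceptionLanguage.≫ext 𝒞 P S E

-- Conditionals are immediate: precomposing a propagator with a pure
-- coprojection is ordinary precomposition, so copairs of propagators are the
-- copairs of the underlying morphisms into  B + E .
--
-- For sequential pairs, extensivity splits the domain of every propagator
-- f : A → B + E  as  A ≅ 𝒟_f + ℰ_f , the part where f terminates normally and
-- the part where it raises.  From extensivity we first derive that the
-- coprojections of  B + E  are monic and disjoint.  We then replace the
-- relation  v ≫ g  by the equivalent and more flexible statement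
-- "v agrees with g wherever g terminates normally", which is local along any
-- such splitting.  The left pair of a pure  f₁  and a propagator  f₂  is built
-- by cases on the splitting of  f₂ : the pure pair  ⟨ f₁ , f₂_normal ⟩  on
-- 𝒟_{f₂}  and the exception of  f₂  on  ℰ_{f₂} ; uniqueness is checked on the
-- same two pieces.  Right pairs follow from left pairs by swapping the
-- product.

module Submission where

open import Level using (_⊔_)
open import Data.Product using (Σ; _×_; _,_; proj₁; proj₂; ∃!)
open import Relation.Binary.PropositionalEquality
  using (_≡_; refl; sym; trans; cong; subst; module ≡-Reasoning)

open import Defs

module CategoryFacts {o ℓ} (𝒞 : Category o ℓ) where
  open Category 𝒞
  open ≡-Reasoning

  assoc⁻ : ∀ {A B C D} {f : A ⇒ B} {g : B ⇒ C} {h : C ⇒ D} →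
           h ∘ (g ∘ f) ≡ (h ∘ g) ∘ f
  assoc⁻ {f = f} {g} {h} = sym (assoc f g h)

  Monic : ∀ {A B} → A ⇒ B → Set (o ⊔ ℓ)
  Monic {A} g = ∀ {X} (a b : X ⇒ A) → g ∘ a ≡ g ∘ b → a ≡ b

  split-epi-epic : ∀ {A C Z} {e : A ⇒ C} {s : C ⇒ A} {a b : C ⇒ Z} →
                   e ∘ s ≡ id → a ∘ e ≡ b ∘ e → a ≡ b
  split-epi-epic {e = e} {s} {a} {b} es ae = begin
    a             ≡⟨ sym (identityʳ a) ⟩
    a ∘ id        ≡⟨ cong (a ∘_) (sym es) ⟩
    a ∘ (e ∘ s)   ≡⟨ assoc⁻ ⟩
    (a ∘ e) ∘ s   ≡⟨ cong (_∘ s) ae ⟩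
    (b ∘ e) ∘ s   ≡⟨ assoc s e b ⟩
    b ∘ (e ∘ s)   ≡⟨ cong (b ∘_) es ⟩
    b ∘ id        ≡⟨ identityʳ b ⟩
    b             ∎

  module _ {A B C} {i : A ⇒ C} {j : B ⇒ C} (cp : IsCoproduct 𝒞 i j) where

    copair-β₁ : ∀ {X} (f : A ⇒ X) (g : B ⇒ X) → proj₁ (cp f g) ∘ i ≡ f
    copair-β₁ f g = proj₁ (proj₁ (proj₂ (cp f g)))

    copair-β₂ : ∀ {X} (f : A ⇒ X) (g : B ⇒ X) → proj₁ (cp f g) ∘ j ≡ g
    copair-β₂ f g = proj₂ (proj₁ (proj₂ (cp f g)))

    coproduct-jointly-epic : ∀ {X} {a b : C ⇒ X} →
                             a ∘ i ≡ b ∘ i → a ∘ j ≡ b ∘ j → a ≡ b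
    coproduct-jointly-epic {a = a} {b} ai aj =
      let u = cp (a ∘ i) (a ∘ j)
      in trans (sym (proj₂ (proj₂ u) (refl , refl))) (proj₂ (proj₂ u) (sym ai , sym aj))

    coproduct-swap : IsCoproduct 𝒞 j i
    coproduct-swap f g =
      let u = cp g f
      in proj₁ u , (copair-β₂ g f , copair-β₁ g f) ,
         λ { (e₁ , e₂) → proj₂ (proj₂ u) (e₂ , e₁) }

    -- a coprojection with a section is an isomorphism: the section is also a
    -- retraction, because  [ id , s ∘ j ]  is a retraction of  i
    split-coprojection-iso : (s : C ⇒ A) → i ∘ s ≡ id → s ∘ i ≡ id
    split-coprojection-iso s is = begin
      s ∘ i               ≡⟨ sym (identityˡ (s ∘ i)) ⟩
      id ∘ (s ∘ i)        ≡⟨ cong (_∘ (s ∘ i)) (sym ti) ⟩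
      (t ∘ i) ∘ (s ∘ i)   ≡⟨ assoc (s ∘ i) i t ⟩
      t ∘ (i ∘ (s ∘ i))   ≡⟨ cong (t ∘_) assoc⁻ ⟩
      t ∘ ((i ∘ s) ∘ i)   ≡⟨ cong (λ z → t ∘ (z ∘ i)) is ⟩
      t ∘ (id ∘ i)        ≡⟨ cong (t ∘_) (identityˡ i) ⟩
      t ∘ i               ≡⟨ ti ⟩
      id                  ∎
      where
        t : C ⇒ A
        t = proj₁ (cp id (s ∘ j))
        ti : t ∘ i ≡ id
        ti = copair-β₁ id (s ∘ j)

    -- if both coprojections have sections, there is at most one morphism out
    -- of  C : both  a  and  b  coincide with  [ a ∘ i , b ∘ j ]
    split-coprojections-collapse : {s : C ⇒ A} {t : C ⇒ B} →
      i ∘ s ≡ id → j ∘ t ≡ id → ∀ {Z} (a b : C ⇒ Z) → a ≡ b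
    split-coprojections-collapse is jt a b =
      trans (sym (split-epi-epic is (copair-β₁ (a ∘ i) (b ∘ j))))
            (split-epi-epic jt (copair-β₂ (a ∘ i) (b ∘ j)))

  module ProductFacts {A B P} {p : P ⇒ A} {q : P ⇒ B} (pr : IsProduct 𝒞 p q) where

    ⟨_,_⟩ : ∀ {X} → X ⇒ A → X ⇒ B → X ⇒ P
    ⟨ f , g ⟩ = proj₁ (pr f g)

    pair-β₁ : ∀ {X} (f : X ⇒ A) (g : X ⇒ B) → p ∘ ⟨ f , g ⟩ ≡ f
    pair-β₁ f g = proj₁ (proj₁ (proj₂ (pr f g)))

    pair-β₂ : ∀ {X} (f : X ⇒ A) (g : X ⇒ B) → q ∘ ⟨ f , g ⟩ ≡ g
    pair-β₂ f g = proj₂ (proj₁ (proj₂ (pr f g)))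

    product-jointly-monic : ∀ {X} {a b : X ⇒ P} →
                            p ∘ a ≡ p ∘ b → q ∘ a ≡ q ∘ b → a ≡ b
    product-jointly-monic {a = a} {b} pa qa =
      let u = pr (p ∘ a) (q ∘ a)
      in trans (sym (proj₂ (proj₂ u) (refl , refl))) (proj₂ (proj₂ u) (sym pa , sym qa))

  product-swap : ∀ {A B P} {p : P ⇒ A} {q : P ⇒ B} →
                 IsProduct 𝒞 p q → IsProduct 𝒞 q p
  product-swap pr f g =
    let u = pr g f
    in proj₁ u , (ProductFacts.pair-β₂ pr g f , ProductFacts.pair-β₁ pr g f) ,
       λ { (e₁ , e₂) → proj₂ (proj₂ u) (e₂ , e₁) }

  module _ {A B C P} {f : A ⇒ C} {g : B ⇒ C} {p : P ⇒ A} {q : P ⇒ B}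
           (pb : IsPullback 𝒞 f g p q) where

    pullback-factor : ∀ {X} (a : X ⇒ A) (b : X ⇒ B) → f ∘ a ≡ g ∘ b →
                      Σ (X ⇒ P) λ u → (p ∘ u ≡ a) × (q ∘ u ≡ b)
    pullback-factor a b e = let u = proj₂ pb a b e in proj₁ u , proj₁ (proj₂ u)

  -- if one leg of a kernel pair of  g  is a coprojection, then  g  is monic:
  -- the diagonal is a section of that leg, so it is an isomorphism inverse to
  -- the diagonal, and therefore both legs are equal
  self-pullback-monic : ∀ {A B C D} {g : A ⇒ B} {i n : C ⇒ A} {j : D ⇒ A} →
    IsPullback 𝒞 g g i n → IsCoproduct 𝒞 i j → Monic g
  self-pullback-monic {A} {C = C} {g = g} {i} {n} pb cp {X} a b e = begin
      a       ≡⟨ sym iu ⟩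
      i ∘ u   ≡⟨ cong (_∘ u) (sym n≡i) ⟩
      n ∘ u   ≡⟨ nu ⟩
      b       ∎
    where
      diagonal : Σ (A ⇒ C) λ s → (i ∘ s ≡ id) × (n ∘ s ≡ id)
      diagonal = pullback-factor pb id id refl
      s : A ⇒ C
      s = proj₁ diagonal
      is : i ∘ s ≡ id
      is = proj₁ (proj₂ diagonal)
      ns : n ∘ s ≡ id
      ns = proj₂ (proj₂ diagonal)
      n≡i : n ≡ i
      n≡i = begin
        n             ≡⟨ sym (identityʳ n) ⟩
        n ∘ id        ≡⟨ cong (n ∘_) (sym (split-coprojection-iso cp s is)) ⟩
        n ∘ (s ∘ i)   ≡⟨ assoc⁻ ⟩
        (n ∘ s) ∘ i   ≡⟨ cong (_∘ i) ns ⟩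
        id ∘ i        ≡⟨ identityˡ i ⟩
        i             ∎
      factor : Σ (X ⇒ C) λ u → (i ∘ u ≡ a) × (n ∘ u ≡ b)
      factor = pullback-factor pb a b e
      u : X ⇒ C
      u = proj₁ factor
      iu : i ∘ u ≡ a
      iu = proj₁ (proj₂ factor)
      nu : n ∘ u ≡ b
      nu = proj₂ (proj₂ factor)

module ExtensiveFacts {o ℓ} (𝒞 : Category o ℓ) (S : FiniteCoproducts 𝒞)
                      (E : Category.Obj 𝒞) (ext : Extensive 𝒞 S E) where
  open Category 𝒞
  open FiniteCoproducts S
  open CategoryFacts 𝒞

  module _ {A B} (f : A ⇒ B + E) where
    private module F = ExtensiveAt (ext f)

    normal-square : f ∘ F.i ≡ inl ∘ F.normal
    normal-square = proj₁ F.pullback₁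

    abrupt-square : f ∘ F.j ≡ inr ∘ F.abrupt
    abrupt-square = proj₁ F.pullback₂

    normal-factor : ∀ {X} (x : X ⇒ A) (m : X ⇒ B) → f ∘ x ≡ inl ∘ m →
                    Σ (X ⇒ F.𝒟) λ u → (F.i ∘ u ≡ x) × (F.normal ∘ u ≡ m)
    normal-factor = pullback-factor F.pullback₁

    abrupt-factor : ∀ {X} (x : X ⇒ A) (e : X ⇒ E) → f ∘ x ≡ inr ∘ e →
                    Σ (X ⇒ F.ℰ) λ w → (F.j ∘ w ≡ x) × (F.abrupt ∘ w ≡ e)
    abrupt-factor = pullback-factor F.pullback₂

    by-cases : ∀ {Z} {a b : A ⇒ Z} → a ∘ F.i ≡ b ∘ F.i → a ∘ F.j ≡ b ∘ F.j → a ≡ b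
    by-cases = coproduct-jointly-epic F.coproduct

  inl-monic : ∀ {B} → Monic (inl {B} {E})
  inl-monic {B} = self-pullback-monic I.pullback₁ I.coproduct
    where module I = ExtensiveAt (ext (inl {B} {E}))

  inr-monic : ∀ {B} → Monic (inr {B} {E})
  inr-monic {B} = self-pullback-monic R.pullback₂ (coproduct-swap R.coproduct)
    where module R = ExtensiveAt (ext (inr {B} {E}))

  -- disjointness: an object on which a normal value and an exception coincide
  -- admits at most one morphism to any object, since both parts of the
  -- splitting of  inl ∘ p  are then split coprojections
  disjoint : ∀ {B Y Z} {p : Y ⇒ B} {q : Y ⇒ E} → inl ∘ p ≡ inr ∘ q →
             (a b : Y ⇒ Z) → a ≡ b
  disjoint {p = p} {q} e =
    split-coprojections-collapse D.coproduct
      (proj₁ (proj₂ (normal-factor (inl ∘ p) id p (identityʳ _))))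
      (proj₁ (proj₂ (abrupt-factor (inl ∘ p) id q (trans (identityʳ _) e))))
    where module D = ExtensiveAt (ext (inl ∘ p))

module ExceptionFacts {o ℓ} (𝒞 : Category o ℓ) (P : FiniteProducts 𝒞)
                      (S : FiniteCoproducts 𝒞) (E : Category.Obj 𝒞)
                      (ext : Extensive 𝒞 S E) where
  open Category 𝒞
  open FiniteProducts P
  open FiniteCoproducts S
  open ExceptionLanguage 𝒞 P S E
    hiding (CompatibleWithConditionals; CompatibleWithSequentialPairs)
  open CategoryFacts 𝒞
  open ExtensiveFacts 𝒞 S E ext
  open ≡-Reasoning

  ⊕-inl : ∀ {B C} (w : B ⇒ C) → (w ⊕ id {E}) ∘ inl ≡ inl ∘ w
  ⊕-inl w = copair-β₁ isCoproduct _ _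

  ⊕-inr : ∀ {B C} (w : B ⇒ C) → (w ⊕ id {E}) ∘ inr ≡ inr
  ⊕-inr w = trans (copair-β₂ isCoproduct _ _) (identityʳ inr)

  μ-inl : ∀ {X} → μ {X} ∘ inl ≡ id
  μ-inl = copair-β₁ isCoproduct _ _

  μ-inr : ∀ {X} → μ {X} ∘ inr ≡ inr
  μ-inr = copair-β₂ isCoproduct _ _

  ∘ₚ-pureʳ : ∀ {A B C} (g : Prop B C) (v : A ⇒ B) → g ∘ₚ pure v ≡ g ∘ v
  ∘ₚ-pureʳ g v = begin
    μ ∘ ((g ⊕ id) ∘ (inl ∘ v))  ≡⟨ cong (μ ∘_) assoc⁻ ⟩
    μ ∘ (((g ⊕ id) ∘ inl) ∘ v)  ≡⟨ cong (λ z → μ ∘ (z ∘ v)) (⊕-inl g) ⟩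
    μ ∘ ((inl ∘ g) ∘ v)         ≡⟨ cong (μ ∘_) (assoc v g inl) ⟩
    μ ∘ (inl ∘ (g ∘ v))         ≡⟨ assoc⁻ ⟩
    (μ ∘ inl) ∘ (g ∘ v)         ≡⟨ cong (_∘ (g ∘ v)) μ-inl ⟩
    id ∘ (g ∘ v)                ≡⟨ identityˡ (g ∘ v) ⟩
    g ∘ v                       ∎

  ∘ₚ-pureˡ : ∀ {A B C} (w : B ⇒ C) (k : Prop A B) → pure w ∘ₚ k ≡ (w ⊕ id) ∘ k
  ∘ₚ-pureˡ w k = trans assoc⁻ (cong (_∘ k) μ∘pure⊕id)
    where
      μ∘pure⊕id : μ ∘ (pure w ⊕ id) ≡ w ⊕ id
      μ∘pure⊕id = coproduct-jointly-epic isCoproduct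
        (begin
          (μ ∘ (pure w ⊕ id)) ∘ inl  ≡⟨ assoc inl (pure w ⊕ id) μ ⟩
          μ ∘ ((pure w ⊕ id) ∘ inl)  ≡⟨ cong (μ ∘_) (⊕-inl (pure w)) ⟩
          μ ∘ (inl ∘ (inl ∘ w))      ≡⟨ assoc⁻ ⟩
          (μ ∘ inl) ∘ (inl ∘ w)      ≡⟨ cong (_∘ (inl ∘ w)) μ-inl ⟩
          id ∘ (inl ∘ w)             ≡⟨ identityˡ (inl ∘ w) ⟩
          inl ∘ w                    ≡⟨ sym (⊕-inl w) ⟩
          (w ⊕ id) ∘ inl             ∎)
        (begin
          (μ ∘ (pure w ⊕ id)) ∘ inr  ≡⟨ assoc inr (pure w ⊕ id) μ ⟩
          μ ∘ ((pure w ⊕ id) ∘ inr)  ≡⟨ cong (μ ∘_) (⊕-inr (pure w)) ⟩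
          μ ∘ inr                    ≡⟨ μ-inr ⟩
          inr                        ≡⟨ sym (⊕-inr w) ⟩
          (w ⊕ id) ∘ inr             ∎)

  ⊕-normal : ∀ {X Y B C} (w : B ⇒ C) {k : Prop Y B} {t : X ⇒ Y} {z : X ⇒ B} →
             k ∘ t ≡ inl ∘ z → ((w ⊕ id) ∘ k) ∘ t ≡ inl ∘ (w ∘ z)
  ⊕-normal w {k} {t} {z} e = begin
    ((w ⊕ id) ∘ k) ∘ t   ≡⟨ assoc t k (w ⊕ id) ⟩
    (w ⊕ id) ∘ (k ∘ t)   ≡⟨ cong ((w ⊕ id) ∘_) e ⟩
    (w ⊕ id) ∘ (inl ∘ z) ≡⟨ assoc⁻ ⟩
    ((w ⊕ id) ∘ inl) ∘ z ≡⟨ cong (_∘ z) (⊕-inl w) ⟩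
    (inl ∘ w) ∘ z        ≡⟨ assoc z w inl ⟩
    inl ∘ (w ∘ z)        ∎

  ⊕-abrupt : ∀ {X Y B C} (w : B ⇒ C) {k : Prop Y B} {t : X ⇒ Y} {e : X ⇒ E} →
             k ∘ t ≡ inr ∘ e → ((w ⊕ id) ∘ k) ∘ t ≡ inr ∘ e
  ⊕-abrupt w {k} {t} {e} eq = begin
    ((w ⊕ id) ∘ k) ∘ t   ≡⟨ assoc t k (w ⊕ id) ⟩
    (w ⊕ id) ∘ (k ∘ t)   ≡⟨ cong ((w ⊕ id) ∘_) eq ⟩
    (w ⊕ id) ∘ (inr ∘ e) ≡⟨ assoc⁻ ⟩
    ((w ⊕ id) ∘ inr) ∘ e ≡⟨ cong (_∘ e) (⊕-inr w) ⟩
    inr ∘ e              ∎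

  -- conversely, if  (w ⊕ id) ∘ k  always raises  e , then so does  k :
  -- on the normal part of  k  a normal value would equal an exception, and on
  -- the exceptional part the raised exception is  e  because  inr  is monic
  ⊕-reflects-abrupt : ∀ {X B C} (w : B ⇒ C) (k : Prop X B) {e : X ⇒ E} →
                      (w ⊕ id) ∘ k ≡ inr ∘ e → k ≡ inr ∘ e
  ⊕-reflects-abrupt w k {e} eq = by-cases k
    (disjoint normal-meets-abrupt _ _)
    (begin
      k ∘ K.j                 ≡⟨ abrupt-square k ⟩
      inr ∘ K.abrupt          ≡⟨ cong (inr ∘_) same-exception ⟩
      inr ∘ (e ∘ K.j)         ≡⟨ assoc⁻ ⟩
      (inr ∘ e) ∘ K.j         ∎)
    where
      module K = ExtensiveAt (ext k)
      same-exception : K.abrupt ≡ e ∘ K.j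
      same-exception = inr-monic _ _ (begin
        inr ∘ K.abrupt          ≡⟨ sym (⊕-abrupt w (abrupt-square k)) ⟩
        ((w ⊕ id) ∘ k) ∘ K.j    ≡⟨ cong (_∘ K.j) eq ⟩
        (inr ∘ e) ∘ K.j         ≡⟨ assoc K.j e inr ⟩
        inr ∘ (e ∘ K.j)         ∎)
      normal-meets-abrupt : inl ∘ (w ∘ K.normal) ≡ inr ∘ (e ∘ K.i)
      normal-meets-abrupt = begin
        inl ∘ (w ∘ K.normal)   ≡⟨ sym (⊕-normal w (normal-square k)) ⟩
        ((w ⊕ id) ∘ k) ∘ K.i   ≡⟨ cong (_∘ K.i) eq ⟩
        (inr ∘ e) ∘ K.i        ≡⟨ assoc K.i e inr ⟩
        inr ∘ (e ∘ K.i)        ∎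

  -- v  agrees with the propagator  g  wherever  g  terminates normally; this
  -- is equivalent to  v ≫ g  and, unlike it, can be checked piecewise
  AgreesOnNormal : ∀ {A B} → A ⇒ B → Prop A B → Set (o ⊔ ℓ)
  AgreesOnNormal {A} {B} v g =
    ∀ {X} (x : X ⇒ A) (m : X ⇒ B) → g ∘ x ≡ inl ∘ m → v ∘ x ≡ m

  ≫⇒agrees : ∀ {A B} {v : A ⇒ B} {g : Prop A B} → ≫ext ext v g → AgreesOnNormal v g
  ≫⇒agrees {v = v} {g} v≫g {X} x m e = begin
    v ∘ x           ≡⟨ cong (v ∘_) (sym iu) ⟩
    v ∘ (G.i ∘ u)   ≡⟨ assoc⁻ ⟩
    (v ∘ G.i) ∘ u   ≡⟨ cong (_∘ u) v≫g ⟩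
    G.normal ∘ u    ≡⟨ nu ⟩
    m               ∎
    where
      module G = ExtensiveAt (ext g)
      factor : Σ (X ⇒ G.𝒟) λ u → (G.i ∘ u ≡ x) × (G.normal ∘ u ≡ m)
      factor = normal-factor g x m e
      u : X ⇒ G.𝒟
      u = proj₁ factor
      iu : G.i ∘ u ≡ x
      iu = proj₁ (proj₂ factor)
      nu : G.normal ∘ u ≡ m
      nu = proj₂ (proj₂ factor)

  agrees⇒≫ : ∀ {A B} {v : A ⇒ B} {g : Prop A B} → AgreesOnNormal v g → ≫ext ext v g
  agrees⇒≫ {g = g} agrees = agrees _ _ (normal-square g)

  agrees-restrict : ∀ {X A B} {v : A ⇒ B} {g : Prop A B} (y : X ⇒ A) →
                    AgreesOnNormal v g → AgreesOnNormal (v ∘ y) (g ∘ y)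
  agrees-restrict {v = v} {g} y agrees x m e =
    trans (assoc x y v) (agrees (y ∘ x) m (trans assoc⁻ e))

  pure-agrees : ∀ {A B} {v : A ⇒ B} {g : Prop A B} → g ≡ inl ∘ v → AgreesOnNormal v g
  pure-agrees {v = v} {g} g≡ x m e = inl-monic _ _ (begin
    inl ∘ (v ∘ x)   ≡⟨ assoc⁻ ⟩
    (inl ∘ v) ∘ x   ≡⟨ cong (_∘ x) (sym g≡) ⟩
    g ∘ x           ≡⟨ e ⟩
    inl ∘ m         ∎)

  raising-agrees : ∀ {A B} {v : A ⇒ B} {g : Prop A B} {e : A ⇒ E} →
                   g ≡ inr ∘ e → AgreesOnNormal v g
  raising-agrees {v = v} {g} {e} g≡ x m eq = disjoint normal-meets-abrupt _ _
    where
      normal-meets-abrupt : inl ∘ m ≡ inr ∘ (e ∘ x)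
      normal-meets-abrupt = begin
        inl ∘ m         ≡⟨ sym eq ⟩
        g ∘ x           ≡⟨ cong (_∘ x) g≡ ⟩
        (inr ∘ e) ∘ x   ≡⟨ assoc x e inr ⟩
        inr ∘ (e ∘ x)   ∎

  agrees-by-cases : ∀ {A B C} {v : A ⇒ C} {g : Prop A C} (f : Prop A B) →
    AgreesOnNormal (v ∘ ExtensiveAt.i (ext f)) (g ∘ ExtensiveAt.i (ext f)) →
    AgreesOnNormal (v ∘ ExtensiveAt.j (ext f)) (g ∘ ExtensiveAt.j (ext f)) →
    AgreesOnNormal v g
  agrees-by-cases {A} {v = v} {g} f on-normal on-abrupt {X} x m e =
    by-cases (f ∘ x) (through F.i normal-piece on-normal) (through F.j abrupt-piece on-abrupt)
    where
      module F = ExtensiveAt (ext f)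
      module Fx = ExtensiveAt (ext (f ∘ x))
      normal-piece : Σ (Fx.𝒟 ⇒ F.𝒟) λ u → F.i ∘ u ≡ x ∘ Fx.i
      normal-piece =
        let (u , iu , _) = normal-factor f (x ∘ Fx.i) Fx.normal
                             (trans assoc⁻ (normal-square (f ∘ x)))
        in u , iu
      abrupt-piece : Σ (Fx.ℰ ⇒ F.ℰ) λ w → F.j ∘ w ≡ x ∘ Fx.j
      abrupt-piece =
        let (w , jw , _) = abrupt-factor f (x ∘ Fx.j) Fx.abrupt
                             (trans assoc⁻ (abrupt-square (f ∘ x)))
        in w , jw
      through : ∀ {D Y} (d : D ⇒ A) {y : Y ⇒ X} → Σ (Y ⇒ D) (λ u → d ∘ u ≡ x ∘ y) →
                AgreesOnNormal (v ∘ d) (g ∘ d) → (v ∘ x) ∘ y ≡ m ∘ y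
      through d {y} (u , du) agrees-on-d = begin
        (v ∘ x) ∘ y   ≡⟨ assoc y x v ⟩
        v ∘ (x ∘ y)   ≡⟨ cong (v ∘_) (sym du) ⟩
        v ∘ (d ∘ u)   ≡⟨ assoc⁻ ⟩
        (v ∘ d) ∘ u   ≡⟨ agrees-on-d u (m ∘ y) (begin
          (g ∘ d) ∘ u   ≡⟨ assoc u d g ⟩
          g ∘ (d ∘ u)   ≡⟨ cong (g ∘_) du ⟩
          g ∘ (x ∘ y)   ≡⟨ assoc⁻ ⟩
          (g ∘ x) ∘ y   ≡⟨ cong (_∘ y) e ⟩
          (inl ∘ m) ∘ y ≡⟨ assoc y m inl ⟩
          inl ∘ (m ∘ y) ∎) ⟩
        m ∘ y         ∎

  module LeftPairs {B₁ B₂ Pr} {p : Pr ⇒ B₁} {q : Pr ⇒ B₂} (pr : IsProduct 𝒞 p q) where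
    open ProductFacts pr

    pure-pair-unique : ∀ {X} (a : X ⇒ B₁) (b : X ⇒ B₂) (k : Prop X Pr) →
      (q ⊕ id) ∘ k ≡ inl ∘ b → AgreesOnNormal a ((p ⊕ id) ∘ k) →
      k ≡ inl ∘ ⟨ a , b ⟩
    pure-pair-unique a b k second first = by-cases k
      (begin
        k ∘ K.i                   ≡⟨ normal-square k ⟩
        inl ∘ K.normal            ≡⟨ cong (inl ∘_) (sym pair∘i) ⟩
        inl ∘ (⟨ a , b ⟩ ∘ K.i)   ≡⟨ assoc⁻ ⟩
        (inl ∘ ⟨ a , b ⟩) ∘ K.i   ∎)
      (disjoint normal-meets-abrupt _ _)
      where
        module K = ExtensiveAt (ext k)
        first-on-i : a ∘ K.i ≡ p ∘ K.normal
        first-on-i = first K.i (p ∘ K.normal) (⊕-normal p (normal-square k))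
        second-on-i : b ∘ K.i ≡ q ∘ K.normal
        second-on-i = inl-monic _ _ (begin
          inl ∘ (b ∘ K.i)        ≡⟨ assoc⁻ ⟩
          (inl ∘ b) ∘ K.i        ≡⟨ cong (_∘ K.i) (sym second) ⟩
          ((q ⊕ id) ∘ k) ∘ K.i   ≡⟨ ⊕-normal q (normal-square k) ⟩
          inl ∘ (q ∘ K.normal)   ∎)
        pair∘i : ⟨ a , b ⟩ ∘ K.i ≡ K.normal
        pair∘i = product-jointly-monic
          (trans assoc⁻ (trans (cong (_∘ K.i) (pair-β₁ a b)) first-on-i))
          (trans assoc⁻ (trans (cong (_∘ K.i) (pair-β₂ a b)) second-on-i))
        normal-meets-abrupt : inl ∘ (b ∘ K.j) ≡ inr ∘ K.abrupt
        normal-meets-abrupt = begin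
          inl ∘ (b ∘ K.j)        ≡⟨ assoc⁻ ⟩
          (inl ∘ b) ∘ K.j        ≡⟨ cong (_∘ K.j) (sym second) ⟩
          ((q ⊕ id) ∘ k) ∘ K.j   ≡⟨ ⊕-abrupt q (abrupt-square k) ⟩
          inr ∘ K.abrupt         ∎

    module _ {A} (f₁ : A ⇒ B₁) (f₂ : Prop A B₂) where
      private module F₂ = ExtensiveAt (ext f₂)

      left-pair : Prop A Pr
      left-pair = proj₁ (F₂.coproduct (inl ∘ ⟨ f₁ ∘ F₂.i , F₂.normal ⟩) (inr ∘ F₂.abrupt))

      left-pair-on-normal : left-pair ∘ F₂.i ≡ inl ∘ ⟨ f₁ ∘ F₂.i , F₂.normal ⟩
      left-pair-on-normal = copair-β₁ F₂.coproduct _ _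

      left-pair-on-abrupt : left-pair ∘ F₂.j ≡ inr ∘ F₂.abrupt
      left-pair-on-abrupt = copair-β₂ F₂.coproduct _ _

      left-pair-second : (q ⊕ id) ∘ left-pair ≡ f₂
      left-pair-second = by-cases f₂
        (begin
          ((q ⊕ id) ∘ left-pair) ∘ F₂.i           ≡⟨ ⊕-normal q left-pair-on-normal ⟩
          inl ∘ (q ∘ ⟨ f₁ ∘ F₂.i , F₂.normal ⟩)   ≡⟨ cong (inl ∘_) (pair-β₂ _ _) ⟩
          inl ∘ F₂.normal                          ≡⟨ sym (normal-square f₂) ⟩
          f₂ ∘ F₂.i                                ∎)
        (trans (⊕-abrupt q left-pair-on-abrupt) (sym (abrupt-square f₂)))

      left-pair-first : AgreesOnNormal f₁ ((p ⊕ id) ∘ left-pair)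
      left-pair-first = agrees-by-cases f₂
        (pure-agrees (begin
          ((p ⊕ id) ∘ left-pair) ∘ F₂.i           ≡⟨ ⊕-normal p left-pair-on-normal ⟩
          inl ∘ (p ∘ ⟨ f₁ ∘ F₂.i , F₂.normal ⟩)   ≡⟨ cong (inl ∘_) (pair-β₁ _ _) ⟩
          inl ∘ (f₁ ∘ F₂.i)                        ∎))
        (raising-agrees (⊕-abrupt p left-pair-on-abrupt))

      -- any propagator with the defining properties coincides with  left-pair
      -- on both parts of  f₂ : on the normal part by the pure case, on the
      -- exceptional part because  q ⊕ id  reflects exceptions
      left-pair-unique : (h : Prop A Pr) → AgreesOnNormal f₁ ((p ⊕ id) ∘ h) →
                         (q ⊕ id) ∘ h ≡ f₂ → left-pair ≡ h
      left-pair-unique h first second = by-cases f₂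
        (trans left-pair-on-normal (sym (pure-pair-unique _ _ (h ∘ F₂.i)
          (trans assoc⁻ (trans (cong (_∘ F₂.i) second) (normal-square f₂)))
          (subst (AgreesOnNormal (f₁ ∘ F₂.i)) (assoc F₂.i h (p ⊕ id))
                 (agrees-restrict F₂.i first)))))
        (trans left-pair-on-abrupt (sym (⊕-reflects-abrupt q (h ∘ F₂.j)
          (trans assoc⁻ (trans (cong (_∘ F₂.j) second) (abrupt-square f₂))))))

      left-pair-universal :
        ∃! _≡_ (λ (h : Prop A Pr) → ≫ext ext f₁ (pure p ∘ₚ h) × (pure q ∘ₚ h ≡ f₂))
      left-pair-universal =
        left-pair ,
        ( agrees⇒≫ (subst (AgreesOnNormal f₁) (sym (∘ₚ-pureˡ p left-pair)) left-pair-first)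
        , trans (∘ₚ-pureˡ q left-pair) left-pair-second ) ,
        λ { {h} (first , second) → left-pair-unique h
              (subst (AgreesOnNormal f₁) (∘ₚ-pureˡ p h) (≫⇒agrees first))
              (trans (sym (∘ₚ-pureˡ q h)) second) }

  conditionals : CompatibleWithConditionals 𝒞 P S E
  conditionals f₁ f₂ =
    [ f₁ , f₂ ] ,
    ( trans (∘ₚ-pureʳ [ f₁ , f₂ ] inl) (copair-β₁ isCoproduct f₁ f₂)
    , trans (∘ₚ-pureʳ [ f₁ , f₂ ] inr) (copair-β₂ isCoproduct f₁ f₂) ) ,
    λ { {h} (e₁ , e₂) → proj₂ (proj₂ (isCoproduct f₁ f₂))
                          (trans (sym (∘ₚ-pureʳ h inl)) e₁ , trans (sym (∘ₚ-pureʳ h inr)) e₂) }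

  -- right pairs are left pairs for the swapped product
  sequential-pairs : CompatibleWithSequentialPairs 𝒞 P S E (≫-extensive 𝒞 P S E ext)
  sequential-pairs =
    (λ f₁ f₂ → LeftPairs.left-pair-universal isProduct f₁ f₂) ,
    (λ f₁ f₂ → swap-conditions (LeftPairs.left-pair-universal (product-swap isProduct) f₂ f₁))
    where
      swap-conditions : ∀ {a b c} {X : Set a} {R : X → Set b} {Q : X → Set c} →
                        ∃! _≡_ (λ x → R x × Q x) → ∃! _≡_ (λ x → Q x × R x)
      swap-conditions (x , (r , q) , unique) = x , (q , r) , λ { (q′ , r′) → unique (r′ , q′) }

theorem4p2 : ∀ {o ℓ} (𝒞 : Category o ℓ) (P : FiniteProducts 𝒞) (S : FiniteCoproducts 𝒞)
    (E : Category.Obj 𝒞) (ext : Extensive 𝒞 S E) →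
    CompatibleWithConditionals 𝒞 P S E
    × CompatibleWithSequentialPairs 𝒞 P S E (≫-extensive 𝒞 P S E ext)
theorem4p2 𝒞 P S E ext = conditionals , sequential-pairs
  where open ExceptionFacts 𝒞 P S E ext
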